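{- For every class of structures, the following three rank functions (each assigning a natural number to every pair consisting of a structure $\mathfrak A$ of the class and a subset $X$ of its universe) are pairwise asymptotically equivalent: (1) the number of distinct rows in the type matrix of $X$ in $\mathfrak A$; (2) the number of distinct columns in the type matrix of $X$ in $\mathfrak A$; (3) the (algebraic) rank of the type matrix of $X$ in $\mathfrak A$, when its values (quantifier-free types) are embedded by an arbitrary injective map into a finite field.
   Context: A vocabulary is a finite set of relation names, each with an arity in $\{1,2,\dots\}$; a structure is a finite universe together with an interpretation of each relation name. A class of structures consists of structures over one vocabulary and is closed under isomorphism. The quantifier-free type of a tuple is the set of quantifier-free formulas (with equality) true of it. If the vocabulary has maximal arity $m$ and $X$ is a subset of the universe of $\mathfrak A$, the type matrix of $X$ has rows indexed by $\bar x\in X^m$, columns indexed by $\bar y\in(\mathfrak A\setminus X)^m$, and entry at $(\bar x,\bar y)$ the quantifier-free type of the $2m$-tuple $\bar x\bar y$. For two functions $\mu_1,\mu_2:D\to\mathbb N$, $\mu_1$ is bounded by $\mu_2$ if for every $Y\subseteq D$, if $\mu_2$ is bounded on $Y$ then $\mu_1$ is bounded on $Y$; they are asymptotically equivalent if each is bounded by the other. -}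

module Defs where

open import Level using (Level; 0ℓ) renaming (suc to lsuc)
open import Data.Nat using (ℕ; zero; suc; _+_; _≤_; _⊔_)
open import Data.Bool using (Bool; true; false; not; _∧_)
open import Data.Fin using (Fin)
open import Data.Fin.Properties using () renaming (_≟_ to _≟ᶠ_)
open import Data.Fin.Subset using (Subset; _∈_; _∉_)
open import Data.Vec using (Vec; []; _∷_; lookup; map; _++_; foldr)
open import Data.Vec.Relation.Unary.All using (All)
open import Data.List using (List; allFin) renaming (foldr to lfoldr)
open import Data.List.Relation.Unary.Any using (Any)
open import Data.Product using (Σ; ∃; _×_; _,_; proj₁)
open import Relation.Nullary using (¬_; Dec; does)
open import Relation.Binary.PropositionalEquality using (_≡_; _≢_)
open import Relation.Binary.Definitions using (Decidable)
open import Function.Bundles using (_⤖_; Bijection)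
open import Algebra.Bundles using (CommutativeRing)

record Vocabulary : Set where
  field
    nRel      : ℕ
    arity     : Fin nRel → ℕ
    arity-pos : ∀ r → 1 ≤ arity r
open Vocabulary public

maxArity : Vocabulary → ℕ
maxArity τ = lfoldr (λ r acc → arity τ r ⊔ acc) 0 (allFin (nRel τ))

record Structure (τ : Vocabulary) : Set where
  field
    size : ℕ
    rel  : (r : Fin (nRel τ)) → Vec (Fin size) (arity τ r) → Bool
open Structure public

record _≅_ {τ : Vocabulary} (A B : Structure τ) : Set where
  field
    bij      : Fin (size A) ⤖ Fin (size B)
    preserve : ∀ (r : Fin (nRel τ)) (a : Vec (Fin (size A)) (arity τ r)) →
               rel A r a ≡ rel B r (map (Bijection.to bij) a)

record Class (τ : Vocabulary) : Set₁ where
  field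
    member     : Structure τ → Set
    iso-closed : ∀ {A B : Structure τ} → A ≅ B → member A → member B
open Class public

data QF (τ : Vocabulary) (k : ℕ) : Set where
  eqᶠ   : Fin k → Fin k → QF τ k
  atomᶠ : (r : Fin (nRel τ)) → Vec (Fin k) (arity τ r) → QF τ k
  ⊤ᶠ    : QF τ k
  ¬ᶠ_   : QF τ k → QF τ k
  _∧ᶠ_  : QF τ k → QF τ k → QF τ k

⟦_⟧ : ∀ {τ k} → QF τ k → (A : Structure τ) → Vec (Fin (size A)) k → Bool
⟦ eqᶠ i j ⟧    A a = does (lookup a i ≟ᶠ lookup a j)
⟦ atomᶠ r v ⟧  A a = rel A r (map (lookup a) v)
⟦ ⊤ᶠ ⟧         A a = true
⟦ ¬ᶠ φ ⟧       A a = not (⟦ φ ⟧ A a)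
⟦ φ ∧ᶠ ψ ⟧     A a = ⟦ φ ⟧ A a ∧ ⟦ ψ ⟧ A a

-- the quantifier-free type of ā in A: the set of qf formulas true of ā
-- (as a characteristic function)
qftp : ∀ {τ k} (A : Structure τ) → Vec (Fin (size A)) k → QF τ k → Bool
qftp A a φ = ⟦ φ ⟧ A a

SameTp : ∀ {τ k} (A : Structure τ) → Vec (Fin (size A)) k →
         (B : Structure τ) → Vec (Fin (size B)) k → Set
SameTp A a B b = ∀ φ → qftp A a φ ≡ qftp B b φ

RowIx : ∀ {τ} (A : Structure τ) → Subset (size A) → Set
RowIx {τ} A X = Σ (Vec (Fin (size A)) (maxArity τ)) (All (_∈ X))

ColIx : ∀ {τ} (A : Structure τ) → Subset (size A) → Set
ColIx {τ} A X = Σ (Vec (Fin (size A)) (maxArity τ)) (All (_∉ X))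

entryTuple : ∀ {τ} (A : Structure τ) (X : Subset (size A)) →
             RowIx A X → ColIx A X →
             Vec (Fin (size A)) (maxArity τ + maxArity τ)
entryTuple A X (x , _) (y , _) = x ++ y

typeMatrix : ∀ {τ} (A : Structure τ) (X : Subset (size A)) →
             RowIx A X → ColIx A X → QF τ (maxArity τ + maxArity τ) → Bool
typeMatrix A X i j = qftp A (entryTuple A X i j)

SameRow : ∀ {τ} (A : Structure τ) (X : Subset (size A)) → RowIx A X → RowIx A X → Set
SameRow A X i i' = ∀ j → SameTp A (entryTuple A X i j) A (entryTuple A X i' j)

SameCol : ∀ {τ} (A : Structure τ) (X : Subset (size A)) → ColIx A X → ColIx A X → Set
SameCol A X j j' = ∀ i → SameTp A (entryTuple A X i j) A (entryTuple A X i j')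

-- Rank functions.  A rank function μ : D → ℕ is represented by the
-- relation  "μ d ≤ b"  (μ d is a maximum, and only its upper bounds matter).

LeRel : Set → Set₁
LeRel D = D → ℕ → Set

Dom : ∀ {τ} → Class τ → Set
Dom {τ} K = Σ (Structure τ) (λ A → member K A × Subset (size A))

Pairwise≢ : ∀ {I : Set} {k} → (I → I → Set) → Vec I k → Set
Pairwise≢ {k = k} R v = ∀ (p q : Fin k) → p ≢ q → ¬ R (lookup v p) (lookup v q)

#rows≤ : ∀ {τ} (K : Class τ) → LeRel (Dom K)
#rows≤ K (A , _ , X) b =
  ∀ {k} (is : Vec (RowIx A X) k) → Pairwise≢ (SameRow A X) is → k ≤ b

#cols≤ : ∀ {τ} (K : Class τ) → LeRel (Dom K)
#cols≤ K (A , _ , X) b =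
  ∀ {k} (js : Vec (ColIx A X) k) → Pairwise≢ (SameCol A X) js → k ≤ b

record FiniteField c ℓ : Set (lsuc (c Level.⊔ ℓ)) where
  field
    commutativeRing : CommutativeRing c ℓ
  open CommutativeRing commutativeRing public
  field
    0≉1      : ¬ (1# ≈ 0#)
    inverse  : ∀ x → ¬ (x ≈ 0#) → ∃ λ y → x * y ≈ 1#
    _≟_      : Decidable _≈_
    elements : List Carrier
    complete : ∀ x → Any (x ≈_) elements

-- An injective map from quantifier-free types of k-tuples (over τ) into F.
-- A type is given by any tuple realising it; ι must be constant on types
-- (well defined) and injective on types.
record TpEmbedding {c ℓ} (τ : Vocabulary) (k : ℕ) (F : FiniteField c ℓ)
       : Set (c Level.⊔ ℓ) where
  open FiniteField F
  field
    ι          : (A : Structure τ) → Vec (Fin (size A)) k → Carrier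
    respects   : ∀ A a B b → SameTp A a B b → ι A a ≈ ι B b
    injective  : ∀ A a B b → ι A a ≈ ι B b → SameTp A a B b

module _ {c ℓ} (F : FiniteField c ℓ) where
  open FiniteField F using (Carrier; _≈_; 0#) renaming (_+_ to _+F_; _*_ to _*F_)

  Σᶠ : ∀ {k} → Vec Carrier k → Carrier
  Σᶠ = foldr _ _+F_ 0#

  LinIndepRows : ∀ {I J : Set} {k} → (I → J → Carrier) → Vec I k → Set (c Level.⊔ ℓ)
  LinIndepRows {J = J} {k} M is =
    ∀ (coef : Vec Carrier k) →
      (∀ (j : J) → Σᶠ (Data.Vec.zipWith (λ a i → a *F M i j) coef is) ≈ 0#) →
      ∀ (p : Fin k) → lookup coef p ≈ 0#

rank≤ : ∀ {c ℓ τ} (K : Class τ) (F : FiniteField c ℓ) →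
        TpEmbedding τ (maxArity τ + maxArity τ) F → Dom K → ℕ → Set (c Level.⊔ ℓ)
rank≤ K F ι (A , _ , X) b =
  ∀ {k} (is : Vec (RowIx A X) k) →
    LinIndepRows F (λ i j → TpEmbedding.ι ι A (entryTuple A X i j)) is → k ≤ b

BoundedOn : ∀ {a} {D : Set} → (D → ℕ → Set a) → (D → Set) → Set a
BoundedOn {D = D} μ≤ Y = ∃ λ b → ∀ (d : D) → Y d → μ≤ d b

BoundedBy : ∀ {a b} {D : Set} → (D → ℕ → Set a) → (D → ℕ → Set b) → Set (lsuc 0ℓ Level.⊔ a Level.⊔ b)
BoundedBy {D = D} μ₁ μ₂ = ∀ (Y : D → Set) → BoundedOn μ₂ Y → BoundedOn μ₁ Y

AsymEquiv : ∀ {a b} {D : Set} → (D → ℕ → Set a) → (D → ℕ → Set b) → Set (lsuc 0ℓ Level.⊔ a Level.⊔ b)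
AsymEquiv μ₁ μ₂ = BoundedBy μ₁ μ₂ × BoundedBy μ₂ μ₁

-- The ranks are compared through maximal families of rows. If R is a maximal family of pairwise
-- distinct rows, every row equals one in R, so a column is determined by its entries in the rows of
-- R. Entries are quantifier-free types of 2m-tuples, and there are at most T of those whatever the
-- structure (a type is fixed by the truth values of the finitely many atomic formulas), so there are
-- at most T^|R| distinct columns; symmetrically for rows. Linearly independent rows are distinct,
-- so the rank is at most the number of distinct rows. Conversely, if R is a maximal linearly
-- independent family, every row r satisfies c₀ r + Σ cᵢ Rᵢ = 0 with c₀ ≠ 0, and these coefficients
-- determine r, so there are at most |F|^(|R|+1) distinct rows. Maximal families can be found
-- constructively because rows, columns and field elements are enumerable up to the relevant
-- equality, which makes every search involved decidable.

module Submission where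

open import Defs
open import Level using (Level; _⊔_; 0ℓ)
open import Data.Nat using (ℕ; zero; suc; _≤_; _^_; s≤s)
open import Data.Nat.Properties
  using (≤-refl; ≤-trans; m≤n⇒m≤1+n; n≤1+n; 1+n≰n; ^-monoˡ-≤; ^-monoʳ-≤)
open import Data.Bool using (not; _∧_)
open import Data.Fin using (Fin; zero; suc; combine)
open import Data.Fin.Properties using (combine-injective; injective⇒≤; ¬∀⟶∃¬; 2↔Bool)
  renaming (_≟_ to _≟ᶠ_; all? to allFin?; any? to anyFin?)
open import Data.Fin.Subset using (Subset)
open import Data.Fin.Subset.Properties using (_∈?_)
open import Data.Vec as Vec using (Vec; []; _∷_; lookup; fromList; replicate; _[_]≔_)
open import Data.Vec.Properties using (∷-injectiveˡ; ∷-injectiveʳ; lookup-map; map-cong)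
import Data.Vec.Relation.Unary.All as VecAll
open import Data.Vec.Relation.Binary.Pointwise.Inductive as PW
  using (Pointwise; []; _∷_; Pointwise-≡⇒≡)
open import Data.List as List using (List; []; _∷_; _++_; allFin; cartesianProductWith; concatMap)
open import Data.List.Relation.Unary.Any as Any using (Any; here; there)
open import Data.List.Relation.Unary.Any.Properties using (cartesianProductWith⁺; lookup-index)
import Data.List.Relation.Unary.All as All
open import Data.List.Relation.Unary.All.Properties using (¬All⇒Any¬)
open import Data.List.Relation.Unary.Enumerates.Setoid using (IsEnumeration)
open import Data.List.Membership.Propositional using (_∈_)
open import Data.List.Membership.Propositional.Properties
  using (∈-allFin; ∈-++⁺ˡ; ∈-++⁺ʳ; ∈-map⁺; ∈-concatMap⁺; ∈-cartesianProductWith⁺)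
open import Data.Product using (Σ; ∃; _×_; _,_; proj₁)
open import Data.Sum using (_⊎_; inj₁; inj₂)
open import Data.Empty using (⊥-elim)
open import Function using (_∘_; flip; id; Injective; Injection)
open import Function.Properties.Inverse using (↔⇒↣; ↔-sym)
open import Relation.Nullary using (¬_; Dec; yes; no)
open import Relation.Nullary.Decidable using (¬?; _→-dec_; decidable-stable; map′)
open import Relation.Unary using (Pred) renaming (Decidable to Decidable₁)
open import Relation.Binary using (Rel; Setoid; IsEquivalence; Symmetric; _Respects_; _⇒_)
  renaming (Decidable to Decidable₂)
open import Relation.Binary.PropositionalEquality as ≡ using (_≡_; _≢_; cong; cong₂)
open import Algebra.Definitions using (AlmostLeftCancellative)
import Algebra.Properties.Group as GroupProperties
import Algebra.Properties.Ring as RingProperties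
import Relation.Binary.Reasoning.Setoid as SetoidReasoning

private
  variable
    a ℓ p r : Level
    A : Set a
    k m n : ℕ

module _ (S : Setoid a ℓ) where
  open Setoid S renaming (Carrier to C)

  all-or-counterexample : ∀ {xs} {P : Pred C p} → IsEnumeration S xs → P Respects _≈_ →
                          Decidable₁ P → (∀ x → P x) ⊎ ∃ (¬_ ∘ P)
  all-or-counterexample {xs = xs} enum resp P? with All.all? P? xs
  ... | yes all = inj₁ (λ x → All.lookupₛ S resp all (enum x))
  ... | no ¬all = inj₂ (Any.satisfied (¬All⇒Any¬ P? xs ¬all))

  all?-enum : ∀ {xs} {P : Pred C p} → IsEnumeration S xs → P Respects _≈_ →
              Decidable₁ P → Dec (∀ x → P x)
  all?-enum enum resp P? with all-or-counterexample enum resp P?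
  ... | inj₁ all = yes all
  ... | inj₂ (x , ¬px) = no (λ all → ¬px (all x))

  any?-enum : ∀ {xs} {P : Pred C p} → IsEnumeration S xs → P Respects _≈_ →
              Decidable₁ P → Dec (∃ P)
  any?-enum enum resp P?
    with all-or-counterexample enum (λ x≈y ¬px py → ¬px (resp (sym x≈y) py)) (¬? ∘ P?)
  ... | inj₁ none = no (λ (x , px) → none x px)
  ... | inj₂ (x , ¬¬px) = yes (x , decidable-stable (P? x) ¬¬px)

vecs : List A → (n : ℕ) → List (Vec A n)
vecs xs zero = [] ∷ []
vecs xs (suc n) = cartesianProductWith _∷_ xs (vecs xs n)

vecs-isEnumeration : (S : Setoid a ℓ) {xs : List (Setoid.Carrier S)} → IsEnumeration S xs →
                     ∀ n → IsEnumeration (PW.setoid S n) (vecs xs n)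
vecs-isEnumeration S enum zero [] = here []
vecs-isEnumeration S enum (suc n) (x ∷ v) =
  cartesianProductWith⁺ _∷_ _∷_ (enum x) (vecs-isEnumeration S enum n v)

∈-vecs : {xs : List A} → (∀ x → x ∈ xs) → (v : Vec A n) → v ∈ vecs xs n
∈-vecs {A = A} enum v = Any.map Pointwise-≡⇒≡ (vecs-isEnumeration (≡.setoid A) enum _ v)

module _ {P : Pred A p} (P? : Decidable₁ P) where

  witnesses : List A → List (Σ A P)
  witnesses [] = []
  witnesses (x ∷ xs) with P? x
  ... | yes px = (x , px) ∷ witnesses xs
  ... | no _ = witnesses xs

  ∈-witnesses : ∀ {x xs} → x ∈ xs → P x → Any ((x ≡_) ∘ proj₁) (witnesses xs)
  ∈-witnesses {xs = y ∷ xs} x∈ px with P? y | x∈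
  ... | yes _ | here ≡.refl = here ≡.refl
  ... | yes _ | there x∈xs = there (∈-witnesses x∈xs px)
  ... | no ¬py | here ≡.refl = ⊥-elim (¬py px)
  ... | no _ | there x∈xs = ∈-witnesses x∈xs px

toFin : Vec (Fin m) n → Fin (m ^ n)
toFin [] = zero
toFin (x ∷ v) = combine x (toFin v)

toFin-injective : Injective _≡_ _≡_ (toFin {m} {n})
toFin-injective {x = []} {[]} _ = ≡.refl
toFin-injective {x = x ∷ v} {y ∷ w} eq with combine-injective x (toFin v) y (toFin w) eq
... | ≡.refl , eq′ = cong (x ∷_) (toFin-injective eq′)

≡-map⇒Pointwise : ∀ {b} {B : Set b} {_≈_ : Rel A ℓ} {f : A → B} →
                  (∀ {x y} → f x ≡ f y → x ≈ y) →
                  ∀ {v w : Vec A n} → Vec.map f v ≡ Vec.map f w → Pointwise _≈_ v w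
≡-map⇒Pointwise f-inj {[]} {[]} _ = []
≡-map⇒Pointwise f-inj {x ∷ v} {y ∷ w} eq =
  f-inj (∷-injectiveˡ eq) ∷ ≡-map⇒Pointwise f-inj (∷-injectiveʳ eq)

m^n≤[1+m]^o : ∀ m {n o} → n ≤ o → m ^ n ≤ suc m ^ o
m^n≤[1+m]^o m {n} n≤o = ≤-trans (^-monoˡ-≤ n (n≤1+n m)) (^-monoʳ-≤ (suc m) n≤o)

-- Pairwise≢ of Defs, at arbitrary universe levels.
Distinct : Rel A r → Vec A k → Set r
Distinct {k = k} R v = ∀ (p q : Fin k) → p ≢ q → ¬ R (lookup v p) (lookup v q)

module _ {R : Rel A r} where

  Distinct-length≤ : ∀ {v : Vec A k} (sig : A → Vec (Fin m) n) →
                     (∀ {x y} → sig x ≡ sig y → R x y) → Distinct R v → k ≤ m ^ n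
  Distinct-length≤ {v = v} sig sig-sound distinct =
    injective⇒≤ {f = toFin ∘ sig ∘ lookup v} λ {p} {q} eq →
      decidable-stable (p ≟ᶠ q) λ p≢q → distinct p q p≢q (sig-sound (toFin-injective eq))

  Distinct-∷ : ∀ {x} {v : Vec A k} → Symmetric R → (∀ q → ¬ R x (lookup v q)) →
               Distinct R v → Distinct R (x ∷ v)
  Distinct-∷ sym new distinct zero zero 0≢0 = ⊥-elim (0≢0 ≡.refl)
  Distinct-∷ sym new distinct zero (suc q) _ = new q
  Distinct-∷ sym new distinct (suc p) zero _ = new p ∘ sym
  Distinct-∷ sym new distinct (suc p) (suc q) p≢q = distinct p q (p≢q ∘ cong suc)

  Distinct? : Decidable₂ R → (v : Vec A k) → Dec (Distinct R v)
  Distinct? R? v = allFin? λ p → allFin? λ q → ¬? (p ≟ᶠ q) →-dec ¬? (R? (lookup v p) (lookup v q))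

  Distinct-resp : IsEquivalence R → (Distinct {k = k} R) Respects (Pointwise R)
  Distinct-resp eq v~w distinct p q p≢q x =
    distinct p q p≢q (trans (PW.lookup v~w p) (trans x (sym (PW.lookup v~w q))))
    where open IsEquivalence eq

  Distinct-anti : ∀ {r′} {R′ : Rel A r′} {v : Vec A k} → R′ ⇒ R → Distinct R v → Distinct R′ v
  Distinct-anti R′⇒R distinct p q p≢q = distinct p q p≢q ∘ R′⇒R

module MaximalFamilies (S : Setoid a ℓ) {xs : List (Setoid.Carrier S)} (enum : IsEnumeration S xs)
  (P : ∀ {k} → Vec (Setoid.Carrier S) k → Set p) (P? : ∀ {k} → Decidable₁ (P {k}))
  (P-resp : ∀ {k} → (P {k}) Respects (Pointwise (Setoid._≈_ S))) (P[] : P []) where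
  open Setoid S renaming (Carrier to C)

  record MaximalFamily (b : ℕ) : Set (a ⊔ p) where
    field
      card      : ℕ
      card≤     : card ≤ b
      members   : Vec C card
      satisfies : P members
      maximal   : ∀ x → ¬ P (x ∷ members)

  private
    largest : ∀ b → ¬ (∃ λ (v : Vec C (suc b)) → P v) → MaximalFamily b
    largest b none with any?-enum (PW.setoid S b) (vecs-isEnumeration S enum b) P-resp P?
    ... | yes (v , pv) = record
      { card = b ; card≤ = ≤-refl ; members = v ; satisfies = pv
      ; maximal = λ x pxv → none (x ∷ v , pxv) }
    largest zero none | no none′ = ⊥-elim (none′ ([] , P[]))
    largest (suc b) none | no none′ =
      let open MaximalFamily (largest b none′) in record
        { card = card ; card≤ = m≤n⇒m≤1+n card≤ ; members = members
        ; satisfies = satisfies ; maximal = maximal }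

  maximalFamily : ∀ {b} → (∀ {k} (v : Vec C k) → P v → k ≤ b) → MaximalFamily b
  maximalFamily bound = largest _ (λ (v , pv) → 1+n≰n (bound v pv))

rowSetoid : ∀ {c ℓ} (C : Setoid c ℓ) {I J : Set} → (I → J → Setoid.Carrier C) → Setoid 0ℓ ℓ
rowSetoid C M = record
  { Carrier = _
  ; _≈_ = λ i i′ → ∀ y → M i y ≈ M i′ y
  ; isEquivalence = record
    { refl = λ _ → C.refl ; sym = λ e y → C.sym (e y) ; trans = λ e f y → C.trans (e y) (f y) } }
  where
  module C = Setoid C
  open C using (_≈_)

colSetoid : ∀ {c ℓ} (C : Setoid c ℓ) {I J : Set} → (I → J → Setoid.Carrier C) → Setoid 0ℓ ℓ
colSetoid C M = rowSetoid C (flip M)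

module RowsAndColumns {c ℓ} (C : Setoid c ℓ) {T : ℕ} (code : Injection C (≡.setoid (Fin T)))
  {I J : Set} (M : I → J → Setoid.Carrier C)
  {xs : List I} (rows : IsEnumeration (rowSetoid C M) xs)
  {ys : List J} (cols : IsEnumeration (colSetoid C M) ys) where
  open Setoid C
  open Injection code using (to; injective) renaming (cong to to-cong)
  open Setoid (rowSetoid C M) using ()
    renaming (_≈_ to _≈ʳ_; sym to ≈ʳ-sym; isEquivalence to ≈ʳ-isEquivalence)
  open Setoid (colSetoid C M) using () renaming (_≈_ to _≈ᶜ_)

  _≈ʳ?_ : Decidable₂ _≈ʳ_
  i ≈ʳ? i′ = all?-enum (colSetoid C M) cols
    (λ y≈y′ e → trans (sym (y≈y′ i)) (trans e (y≈y′ i′)))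
    (λ y → map′ injective to-cong (to (M i y) ≟ᶠ to (M i′ y)))

  #cols≤[1+T]^#rows : ∀ {b} → (∀ {k} (v : Vec I k) → Distinct _≈ʳ_ v → k ≤ b) →
                      ∀ {k} (w : Vec J k) → Distinct _≈ᶜ_ w → k ≤ suc T ^ b
  #cols≤[1+T]^#rows bound w distinct =
    ≤-trans (Distinct-length≤ {v = w} signature signature-sound distinct) (m^n≤[1+m]^o T card≤)
    where
    module Max = MaximalFamilies (rowSetoid C M) rows (Distinct _≈ʳ_) (Distinct? _≈ʳ?_)
                                 (Distinct-resp ≈ʳ-isEquivalence) (λ ())
    open Max.MaximalFamily (Max.maximalFamily bound)

    representative : ∀ i → ∃ λ q → i ≈ʳ lookup members q
    representative i with anyFin? (λ q → i ≈ʳ? lookup members q)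
    ... | yes found = found
    ... | no ¬found =
      ⊥-elim (maximal i (Distinct-∷ {x = i} {v = members} ≈ʳ-sym (λ q e → ¬found (q , e)) satisfies))

    signature : J → Vec (Fin T) card
    signature y = Vec.map (λ i → to (M i y)) members

    signature-sound : ∀ {y y′} → signature y ≡ signature y′ → y ≈ᶜ y′
    signature-sound {y} {y′} eq i with representative i
    ... | q , i≈ = trans (i≈ y) (trans (injective same-code) (sym (i≈ y′)))
      where
      same-code : to (M (lookup members q) y) ≡ to (M (lookup members q) y′)
      same-code = ≡.trans (≡.sym (lookup-map q _ members))
                          (≡.trans (cong (λ u → lookup u q) eq) (lookup-map q _ members))

module _ {c ℓ} (F : FiniteField c ℓ) where
  open FiniteField F
  open SetoidReasoning setoid

  index : Carrier → Fin (List.length elements)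
  index x = Any.index (complete x)

  index-injective : ∀ {x y} → index x ≡ index y → x ≈ y
  index-injective {x} {y} eq = trans (lookup-index (complete x))
    (trans (reflexive (cong (List.lookup elements) eq)) (sym (lookup-index (complete y))))

  *-cancelˡ-nonZero : AlmostLeftCancellative _≈_ 0# _*_
  *-cancelˡ-nonZero x y z x≉0 xy≈xz with inverse x x≉0
  ... | x⁻¹ , xx⁻¹≈1 = trans (undo y) (trans (*-congˡ xy≈xz) (sym (undo z)))
    where
    undo : ∀ w → w ≈ x⁻¹ * (x * w)
    undo w = begin
      w                ≈⟨ *-identityˡ w ⟨
      1# * w           ≈⟨ *-congʳ xx⁻¹≈1 ⟨
      (x * x⁻¹) * w    ≈⟨ *-congʳ (*-comm x x⁻¹) ⟩
      (x⁻¹ * x) * w    ≈⟨ *-assoc x⁻¹ x w ⟩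
      x⁻¹ * (x * w)    ∎

module LinearIndependence {c ℓ} (F : FiniteField c ℓ) {I J : Set}
  (M : I → J → FiniteField.Carrier F) where
  open FiniteField F hiding (zero)
  open GroupProperties +-group using (∙-cancelʳ)
  open RingProperties ring using (-1*x≈-x)
  open SetoidReasoning setoid
  open Setoid (rowSetoid setoid M) using ()
    renaming (_≈_ to _≈ʳ_; sym to ≈ʳ-sym)
  open Setoid (colSetoid setoid M) using () renaming (_≈_ to _≈ᶜ_)

  combination : Vec Carrier k → Vec I k → J → Carrier
  combination cs is y = Σᶠ F (Vec.zipWith (λ a i → a * M i y) cs is)

  Vanishes : Vec I k → Vec Carrier k → Set ℓ
  Vanishes is cs = ∀ y → combination cs is y ≈ 0#

  VanishingIsTrivial : Vec I k → Vec Carrier k → Set ℓ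
  VanishingIsTrivial is cs = Vanishes is cs → ∀ p → lookup cs p ≈ 0#

  combination-congˡ : ∀ {cs cs′ : Vec Carrier k} → Pointwise _≈_ cs cs′ →
                      ∀ is y → combination cs is y ≈ combination cs′ is y
  combination-congˡ [] [] y = refl
  combination-congˡ (c≈ ∷ cs≈) (i ∷ is) y = +-cong (*-congʳ c≈) (combination-congˡ cs≈ is y)

  combination-congʳ : ∀ cs {is is′ : Vec I k} → Pointwise _≈ʳ_ is is′ →
                      ∀ y → combination cs is y ≈ combination cs is′ y
  combination-congʳ [] [] y = refl
  combination-congʳ (c ∷ cs) (i≈ ∷ is≈) y = +-cong (*-congˡ (i≈ y)) (combination-congʳ cs is≈ y)

  combination-colCong : ∀ cs (is : Vec I k) {y y′} → y ≈ᶜ y′ →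
                        combination cs is y ≈ combination cs is y′
  combination-colCong [] [] y≈ = refl
  combination-colCong (c ∷ cs) (i ∷ is) y≈ = +-cong (*-congˡ (y≈ i)) (combination-colCong cs is y≈)

  combination-0∷ : ∀ cs i (is : Vec I k) y → combination (0# ∷ cs) (i ∷ is) y ≈ combination cs is y
  combination-0∷ cs i is y = trans (+-congʳ (zeroˡ (M i y))) (+-identityˡ _)

  combination-zeros : ∀ (is : Vec I k) y → combination (replicate k 0#) is y ≈ 0#
  combination-zeros [] y = refl
  combination-zeros (i ∷ is) y =
    trans (combination-0∷ (replicate _ 0#) i is y) (combination-zeros is y)

  combination-unit : ∀ (is : Vec I k) q x y →
                     combination (replicate k 0# [ q ]≔ x) is y ≈ x * M (lookup is q) y
  combination-unit (i ∷ is) zero x y = trans (+-congˡ (combination-zeros is y)) (+-identityʳ _)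
  combination-unit (i ∷ is) (suc q) x y =
    trans (combination-0∷ (replicate _ 0# [ q ]≔ x) i is y) (combination-unit is q x y)

  LinIndep-resp : (LinIndepRows F {k = k} M) Respects (Pointwise _≈ʳ_)
  LinIndep-resp is≈is′ independent cs vanishes =
    independent cs (λ y → trans (combination-congʳ cs is≈is′ y) (vanishes y))

  LinIndep-tail : ∀ {i} {is : Vec I k} → LinIndepRows F M (i ∷ is) → LinIndepRows F M is
  LinIndep-tail {i = i} {is} independent cs vanishes p =
    independent (0# ∷ cs) (λ y → trans (combination-0∷ cs i is y) (vanishes y)) (suc p)

  LinIndep-head : ∀ {i} {is : Vec I k} → LinIndepRows F M (i ∷ is) → ∀ q → ¬ i ≈ʳ lookup is q
  LinIndep-head {k} {i} {is} independent q i≈ = 0≉1 (independent (1# ∷ eₚ) vanishes zero)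
    where
    eₚ : Vec Carrier k
    eₚ = replicate _ 0# [ q ]≔ - 1#
    vanishes : Vanishes (i ∷ is) (1# ∷ eₚ)
    vanishes y = begin
      1# * M i y + combination eₚ is y          ≈⟨ +-cong (*-identityˡ _) (combination-unit is q (- 1#) y) ⟩
      M i y + - 1# * M (lookup is q) y           ≈⟨ +-cong (i≈ y) (-1*x≈-x _) ⟩
      M (lookup is q) y + - M (lookup is q) y    ≈⟨ -‿inverseʳ _ ⟩
      0#                                         ∎

  LinIndep⇒Distinct : ∀ {is : Vec I k} → LinIndepRows F M is → Distinct _≈ʳ_ is
  LinIndep⇒Distinct {is = []} independent ()
  LinIndep⇒Distinct {is = i ∷ is} independent =
    Distinct-∷ {x = i} {v = is} ≈ʳ-sym (LinIndep-head independent)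
      (LinIndep⇒Distinct (LinIndep-tail independent))

  record Dependence (is : Vec I k) : Set (c ⊔ ℓ) where
    field
      coefficients : Vec Carrier k
      vanishes     : Vanishes is coefficients
      nontrivial   : ∃ λ p → ¬ lookup coefficients p ≈ 0#

  leading-nonzero : ∀ {i} {is : Vec I k} → LinIndepRows F M is →
                    (d : Dependence (i ∷ is)) → ¬ Vec.head (Dependence.coefficients d) ≈ 0#
  leading-nonzero {i = i} {is} independent
    record { coefficients = c₀ ∷ cs ; vanishes = vanishes ; nontrivial = p , cₚ≉0 } c₀≈0 =
    cₚ≉0 (all-zero p)
    where
    all-zero : ∀ p → lookup (c₀ ∷ cs) p ≈ 0#
    all-zero zero = c₀≈0
    all-zero (suc p) = independent cs (λ y → begin
      combination cs is y               ≈⟨ combination-0∷ cs i is y ⟨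
      combination (0# ∷ cs) (i ∷ is) y
        ≈⟨ combination-congˡ (sym c₀≈0 ∷ PW.refl refl {cs}) (i ∷ is) y ⟩
      combination (c₀ ∷ cs) (i ∷ is) y  ≈⟨ vanishes y ⟩
      0#                                ∎) p

  row-determined : ∀ {i i′} {is : Vec I k} → LinIndepRows F M is →
                   (d : Dependence (i ∷ is)) (d′ : Dependence (i′ ∷ is)) →
                   Pointwise _≈_ (Dependence.coefficients d) (Dependence.coefficients d′) → i ≈ʳ i′
  row-determined {i = i} {i′} {is} independent
    d@record { coefficients = c₀ ∷ cs ; vanishes = vanishes } d′ c≈c′ y =
    *-cancelˡ-nonZero F c₀ (M i y) (M i′ y) (leading-nonzero independent d)
      (∙-cancelʳ (combination cs is y) _ _ (begin
        c₀ * M i y + combination cs is y    ≈⟨ vanishes y ⟩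
        0#                                  ≈⟨ Dependence.vanishes d′ y ⟨
        combination (Dependence.coefficients d′) (i′ ∷ is) y
                                            ≈⟨ combination-congˡ c≈c′ (i′ ∷ is) y ⟨
        c₀ * M i′ y + combination cs is y   ∎))

  module _ {ys : List J} (cols : IsEnumeration (colSetoid setoid M) ys) where

    vanishes? : ∀ (is : Vec I k) cs → Dec (Vanishes is cs)
    vanishes? is cs = all?-enum (colSetoid setoid M) cols
      (λ y≈ vanishes → trans (sym (combination-colCong cs is y≈)) vanishes)
      (λ y → combination cs is y ≟ 0#)

    independent-or-dependent : (is : Vec I k) → LinIndepRows F M is ⊎ Dependence is
    independent-or-dependent {k} is
      with all-or-counterexample (PW.setoid setoid k) {P = VanishingIsTrivial is}
             (vecs-isEnumeration setoid complete k) trivial-resp (λ cs → vanishes? is cs →-dec zeros? cs)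
      where
      zeros? : ∀ cs → Dec (∀ p → lookup cs p ≈ 0#)
      zeros? cs = allFin? (λ p → lookup cs p ≟ 0#)
      trivial-resp : (VanishingIsTrivial is) Respects (Pointwise _≈_)
      trivial-resp cs≈ trivial vanishes p =
        trans (sym (PW.lookup cs≈ p))
              (trivial (λ y → trans (combination-congˡ cs≈ is y) (vanishes y)) p)
    ... | inj₁ independent = inj₁ independent
    ... | inj₂ (cs , ¬trivial) with vanishes? is cs | allFin? (λ p → lookup cs p ≟ 0#)
    ...   | no ¬vanishes | _ = ⊥-elim (¬trivial (⊥-elim ∘ ¬vanishes))
    ...   | yes _ | yes zeros = ⊥-elim (¬trivial (λ _ → zeros))
    ...   | yes vanishes | no ¬zeros = inj₂ record
      { coefficients = cs ; vanishes = vanishes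
      ; nontrivial = ¬∀⟶∃¬ k _ (λ p → lookup cs p ≟ 0#) ¬zeros }

    LinIndep? : (is : Vec I k) → Dec (LinIndepRows F M is)
    LinIndep? is with independent-or-dependent is
    ... | inj₁ independent = yes independent
    ... | inj₂ record { coefficients = cs ; vanishes = vanishes ; nontrivial = p , cₚ≉0 } =
      no (λ independent → cₚ≉0 (independent cs vanishes p))

    #rows≤[1+|F|]^[1+rank] : ∀ {xs : List I} → IsEnumeration (rowSetoid setoid M) xs → ∀ {b} →
                             (∀ {k} (v : Vec I k) → LinIndepRows F M v → k ≤ b) →
                             ∀ {k} (v : Vec I k) → Distinct _≈ʳ_ v →
                             k ≤ suc (List.length elements) ^ suc b
    #rows≤[1+|F|]^[1+rank] rows bound v distinct =
      ≤-trans (Distinct-length≤ {v = v} signature signature-sound distinct)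
              (m^n≤[1+m]^o _ (s≤s card≤))
      where
      module Max = MaximalFamilies (rowSetoid setoid M) rows (LinIndepRows F M) LinIndep?
                                   LinIndep-resp (λ _ _ ())
      open Max.MaximalFamily (Max.maximalFamily bound)

      dependence : ∀ i → Dependence (i ∷ members)
      dependence i with independent-or-dependent (i ∷ members)
      ... | inj₁ independent = ⊥-elim (maximal i independent)
      ... | inj₂ d = d

      signature : I → Vec (Fin (List.length elements)) (suc card)
      signature i = Vec.map (index F) (Dependence.coefficients (dependence i))

      signature-sound : ∀ {i i′} → signature i ≡ signature i′ → i ≈ʳ i′
      signature-sound eq = row-determined satisfies (dependence _) (dependence _)
                                          (≡-map⇒Pointwise (index-injective F) eq)

module QuantifierFreeTypes (τ : Vocabulary) (n : ℕ) where

  relationAtoms : Fin (nRel τ) → List (QF τ n)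
  relationAtoms r = List.map (atomᶠ r) (vecs (allFin n) (arity τ r))

  atoms : List (QF τ n)
  atoms = cartesianProductWith eqᶠ (allFin n) (allFin n) ++ concatMap relationAtoms (allFin (nRel τ))

  SameTp-atoms : ∀ A B {a b} → (∀ {φ} → φ ∈ atoms → ⟦ φ ⟧ A a ≡ ⟦ φ ⟧ B b) →
                 SameTp A a B b
  SameTp-atoms A B agree (eqᶠ i j) =
    agree (∈-++⁺ˡ (∈-cartesianProductWith⁺ eqᶠ (∈-allFin i) (∈-allFin j)))
  SameTp-atoms A B agree (atomᶠ r v) =
    agree (∈-++⁺ʳ _ (∈-concatMap⁺ relationAtoms
      (Any.map (λ { ≡.refl → ∈-map⁺ (atomᶠ r) (∈-vecs ∈-allFin v) }) (∈-allFin r))))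
  SameTp-atoms A B agree ⊤ᶠ = ≡.refl
  SameTp-atoms A B agree (¬ᶠ φ) = cong not (SameTp-atoms A B agree φ)
  SameTp-atoms A B agree (φ ∧ᶠ ψ) = cong₂ _∧_ (SameTp-atoms A B agree φ) (SameTp-atoms A B agree ψ)

  tpSetoid : Structure τ → Setoid 0ℓ 0ℓ
  tpSetoid A = record
    { Carrier = Vec (Fin (size A)) n
    ; _≈_ = λ a b → SameTp A a A b
    ; isEquivalence = record
      { refl = λ _ → ≡.refl
      ; sym = λ s φ → ≡.sym (s φ)
      ; trans = λ s t φ → ≡.trans (s φ) (t φ) } }

  #types : ℕ
  #types = 2 ^ List.length atoms

  tpCode : (A : Structure τ) → Injection (tpSetoid A) (≡.setoid (Fin #types))
  tpCode A = record { to = code ; cong = code-cong ; injective = code-injective }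
    where
    open Injection (↔⇒↣ (↔-sym 2↔Bool)) using () renaming (to to bit; injective to bit-injective)

    bits : Vec (Fin (size A)) n → (φs : List (QF τ n)) → Vec (Fin 2) (List.length φs)
    bits a φs = Vec.map (λ φ → bit (⟦ φ ⟧ A a)) (fromList φs)

    code : Vec (Fin (size A)) n → Fin #types
    code a = toFin (bits a atoms)

    code-cong : ∀ {a b} → SameTp A a A b → code a ≡ code b
    code-cong same = cong toFin (map-cong (λ φ → cong bit (same φ)) (fromList atoms))

    agree : ∀ {a b φ φs} → bits a φs ≡ bits b φs → φ ∈ φs → ⟦ φ ⟧ A a ≡ ⟦ φ ⟧ A b
    agree eq (here ≡.refl) = bit-injective (∷-injectiveˡ eq)
    agree eq (there φ∈) = agree (∷-injectiveʳ eq) φ∈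

    code-injective : ∀ {a b} → code a ≡ code b → SameTp A a A b
    code-injective eq = SameTp-atoms A A (agree (toFin-injective eq))

-- Imported only here: it would clash with the field addition of the modules above.
open import Data.Nat using (_+_)

module TypeMatrix {τ : Vocabulary} (A : Structure τ) (X : Subset (size A)) where

  tuples : List (Vec (Fin (size A)) (maxArity τ))
  tuples = vecs (allFin (size A)) (maxArity τ)

  rowIxs : List (RowIx A X)
  rowIxs = witnesses (VecAll.all? (_∈? X)) tuples

  colIxs : List (ColIx A X)
  colIxs = witnesses (VecAll.all? (¬? ∘ (_∈? X))) tuples

  module _ {c ℓ} (C : Setoid c ℓ)
           (f : Vec (Fin (size A)) (maxArity τ + maxArity τ) → Setoid.Carrier C) where
    open Setoid C using (reflexive)

    rowIxs-isEnumeration : IsEnumeration (rowSetoid C (λ i j → f (entryTuple A X i j))) rowIxs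
    rowIxs-isEnumeration (v , v⊆X) =
      Any.map (λ v≡ j → reflexive (cong (λ u → f (u Vec.++ proj₁ j)) v≡))
              (∈-witnesses _ (∈-vecs ∈-allFin v) v⊆X)

    colIxs-isEnumeration : IsEnumeration (colSetoid C (λ i j → f (entryTuple A X i j))) colIxs
    colIxs-isEnumeration (v , v∩X≡∅) =
      Any.map (λ v≡ i → reflexive (cong (λ u → f (proj₁ i Vec.++ u)) v≡))
              (∈-witnesses _ (∈-vecs ∈-allFin v) v∩X≡∅)

boundedBy : ∀ {a b} {D : Set} {μ₁ : D → ℕ → Set a} {μ₂ : D → ℕ → Set b} (f : ℕ → ℕ) →
            (∀ d {n} → μ₂ d n → μ₁ d (f n)) → BoundedBy μ₁ μ₂
boundedBy f bound Y (n , μ₂≤n) = f n , λ d d∈Y → bound d (μ₂≤n d d∈Y)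

BoundedBy-trans : ∀ {a b e} {D : Set} {μ₁ : D → ℕ → Set a} {μ₂ : D → ℕ → Set b}
                  {μ₃ : D → ℕ → Set e} → BoundedBy μ₁ μ₂ → BoundedBy μ₂ μ₃ → BoundedBy μ₁ μ₃
BoundedBy-trans μ₁≼μ₂ μ₂≼μ₃ Y = μ₁≼μ₂ Y ∘ μ₂≼μ₃ Y

module _ {τ : Vocabulary} (K : Class τ) where
  open QuantifierFreeTypes τ (maxArity τ + maxArity τ) using (tpSetoid; tpCode; #types)

  #cols≤-from-#rows≤ : ∀ d {b} → #rows≤ K d b → #cols≤ K d (suc #types ^ b)
  #cols≤-from-#rows≤ (A , _ , X) = RowsAndColumns.#cols≤[1+T]^#rows (tpSetoid A) (tpCode A)
    (entryTuple A X) (rowIxs-isEnumeration (tpSetoid A) id) (colIxs-isEnumeration (tpSetoid A) id)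
    where open TypeMatrix A X

  #rows≤-from-#cols≤ : ∀ d {b} → #cols≤ K d b → #rows≤ K d (suc #types ^ b)
  #rows≤-from-#cols≤ (A , _ , X) = RowsAndColumns.#cols≤[1+T]^#rows (tpSetoid A) (tpCode A)
    (flip (entryTuple A X)) (colIxs-isEnumeration (tpSetoid A) id) (rowIxs-isEnumeration (tpSetoid A) id)
    where open TypeMatrix A X

  module _ {c ℓ} (F : FiniteField c ℓ) (ι : TpEmbedding τ (maxArity τ + maxArity τ) F) where
    open FiniteField F using (Carrier; setoid)
    open TpEmbedding ι using (respects; injective) renaming (ι to embed)

    module _ (A : Structure τ) (X : Subset (size A)) where

      embeddedMatrix : RowIx A X → ColIx A X → Carrier
      embeddedMatrix i j = embed A (entryTuple A X i j)

      SameRow⇒≈ʳ : SameRow A X ⇒ Setoid._≈_ (rowSetoid setoid embeddedMatrix)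
      SameRow⇒≈ʳ same y = respects A _ A _ (same y)

      ≈ʳ⇒SameRow : Setoid._≈_ (rowSetoid setoid embeddedMatrix) ⇒ SameRow A X
      ≈ʳ⇒SameRow same y = injective A _ A _ (same y)

    -- Row indices carry membership proofs that SameRow ignores, so they are passed explicitly.
    rank≤-from-#rows≤ : ∀ d {b} → #rows≤ K d b → rank≤ K F ι d b
    rank≤-from-#rows≤ (A , _ , X) bound v independent =
      bound v (Distinct-anti {v = v} (λ {i} {i′} → SameRow⇒≈ʳ A X {i} {i′})
                (LinearIndependence.LinIndep⇒Distinct F (embeddedMatrix A X) independent))

    #rows≤-from-rank≤ : ∀ d {b} → rank≤ K F ι d b →
                        #rows≤ K d (suc (List.length (FiniteField.elements F)) ^ suc b)
    #rows≤-from-rank≤ (A , _ , X) bound v distinct =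
      LinearIndependence.#rows≤[1+|F|]^[1+rank] F (embeddedMatrix A X)
        (colIxs-isEnumeration setoid (embed A)) (rowIxs-isEnumeration setoid (embed A))
        bound v (Distinct-anti {v = v} (λ {i} {i′} → ≈ʳ⇒SameRow A X {i} {i′}) distinct)
      where open TypeMatrix A X

lemma3p4 : ∀ {c ℓ} (τ : Vocabulary) (K : Class τ) →
    AsymEquiv (#rows≤ K) (#cols≤ K) ×
    ((F : FiniteField c ℓ) (ι : TpEmbedding τ (maxArity τ + maxArity τ) F) →
      AsymEquiv (#rows≤ K) (rank≤ K F ι) × AsymEquiv (#cols≤ K) (rank≤ K F ι))
lemma3p4 τ K = (rows≼cols , cols≼rows) , λ F ι →
  let rows≼rank : BoundedBy (#rows≤ K) (rank≤ K F ι)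
      rows≼rank = boundedBy _ (#rows≤-from-rank≤ K F ι)
      rank≼rows : BoundedBy (rank≤ K F ι) (#rows≤ K)
      rank≼rows = boundedBy _ (rank≤-from-#rows≤ K F ι)
  in (rows≼rank , rank≼rows)
   , (BoundedBy-trans cols≼rows rows≼rank , BoundedBy-trans rank≼rows rows≼cols)
  where
  rows≼cols : BoundedBy (#rows≤ K) (#cols≤ K)
  rows≼cols = boundedBy _ (#rows≤-from-#cols≤ K)
  cols≼rows : BoundedBy (#cols≤ K) (#rows≤ K)
  cols≼rows = boundedBy _ (#cols≤-from-#rows≤ K)
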